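{- In Ruleset A, for all integers $i,j>0$, $\langle \mathrm{Nim}(i,0),\mathrm{Nim}(0,j)\rangle_A\equiv *\big(\max(i,j)-1+\delta_{i,j}\big)$, where $\delta_{i,j}$ is the Kronecker delta.
   Context: $\mathrm{Nim}(x_1,x_2)$ is the Nim position with two heaps of $x_1$ and $x_2$ tokens; a classical move $(h,-t)$ with $h\in\{1,2\}$, $t\ge1$ removes $t$ tokens from heap $h$ and is legal iff heap $h$ has at least $t$ tokens. Quantum variation: a quantum position is a finite nonempty set $\langle G_1,\dots,G_n\rangle$ of classical positions (multiplicities irrelevant). A classical move is legal in it if legal in at least one $G_i$. A Q-move is a finite nonempty set of classical moves, each legal in the current quantum position (possibly moves on different heaps); it leads to the set of all positions obtained by applying one of its moves to one of the $G_i$ where that move is legal. Ruleset A (subscript $A$): only Q-moves containing at least two distinct classical moves are allowed. Normal convention: a player with no allowed Q-move loses. $*n$ denotes the value (equivalence class under $G\equiv H$ iff $G+X$, $H+X$ have the same outcome for all games $X$) of a classical Nim heap of $n$ tokens, with $*0=0$. -}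

module Defs where

open import Level using (0ℓ)
open import Data.Nat using (ℕ; zero; suc; _≤_; _<_; _∸_; _≡ᵇ_)
open import Data.Bool using (if_then_else_)
open import Data.Product using (Σ; _×_; _,_; ∃; ∃-syntax)
open import Data.List using (List)
open import Data.List.Membership.Propositional using (_∈_)
open import Relation.Binary.PropositionalEquality using (_≡_; _≢_)
open import Function.Bundles using (_⇔_)

record Graph : Set₁ where
  field
    Pos : Set
    Opt : Pos → Pos → Set   -- Opt p q : q is an option of p

open Graph public

-- Normal play: Win p = player to move from p wins (N-position),
-- Lose p = player to move loses (P-position).
mutual
  data Win (G : Graph) : Pos G → Set where
    win : ∀ {p q} → Opt G p q → Lose G q → Win G p

  data Lose (G : Graph) : Pos G → Set where
    lose : ∀ {p} → (∀ {q} → Opt G p q → Win G q) → Lose G p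

-- Short impartial games as finite game trees (the test games X).
data Tree : Set where
  node : List Tree → Tree

TreeGraph : Graph
TreeGraph = record { Pos = Tree ; Opt = λ { (node ts) t → t ∈ ts } }

_⊕_ : Graph → Graph → Graph
G ⊕ H = record
  { Pos = Pos G × Pos H
  ; Opt = λ { (g , h) (g′ , h′) →
        (Opt G g g′ × h′ ≡ h) Data.Sum.⊎ (g′ ≡ g × Opt H h h′) }
  }
  where import Data.Sum

Game : Set₁
Game = Σ Graph Pos

_≡g_ : Game → Game → Set
(G , g) ≡g (H , h) = ∀ (X : Tree) →
  (Lose (G ⊕ TreeGraph) (g , X) ⇔ Lose (H ⊕ TreeGraph) (h , X)) ×
  (Win  (G ⊕ TreeGraph) (g , X) ⇔ Win  (H ⊕ TreeGraph) (h , X))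

NimGraph : Graph
NimGraph = record { Pos = ℕ ; Opt = λ n m → m < n }

star : ℕ → Game
star n = NimGraph , n

ClassicalPos : Set
ClassicalPos = ℕ × ℕ

Nim : ℕ → ℕ → ClassicalPos
Nim x₁ x₂ = x₁ , x₂

data Heap : Set where
  h₁ h₂ : Heap

record CMove : Set where
  constructor mv
  field
    heap   : Heap
    tokens : ℕ

Legal : CMove → ClassicalPos → Set
Legal (mv h₁ t) (a , b) = 1 ≤ t × t ≤ a
Legal (mv h₂ t) (a , b) = 1 ≤ t × t ≤ b

apply : CMove → ClassicalPos → ClassicalPos
apply (mv h₁ t) (a , b) = a ∸ t , b
apply (mv h₂ t) (a , b) = a , b ∸ t

-- Quantum positions: finite sets of classical positions, represented by
-- lists (multiplicity/order irrelevant: only membership is ever used).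
QPos : Set
QPos = List ClassicalPos

LegalQ : CMove → QPos → Set
LegalQ m Q = ∃[ G ] (G ∈ Q × Legal m G)

AllowedA : QPos → List CMove → Set
AllowedA Q M =
  (∀ {m} → m ∈ M → LegalQ m Q) ×
  (∃[ m ] ∃[ m′ ] (m ∈ M × m′ ∈ M × m ≢ m′))

Result : QPos → List CMove → QPos → Set
Result Q M Q′ = ∀ p → p ∈ Q′ ⇔ (∃[ m ] ∃[ G ] (m ∈ M × G ∈ Q × Legal m G × p ≡ apply m G))

QNimA : Graph
QNimA = record
  { Pos = QPos
  ; Opt = λ Q Q′ → ∃[ M ] (AllowedA Q M × Result Q M Q′)
  }

⟨_⟩A : List ClassicalPos → Game
⟨ Q ⟩A = QNimA , Q

δ : ℕ → ℕ → ℕ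
δ i j = if i ≡ᵇ j then 1 else 0

module Submission where

-- A quantum position Q whose members each have at most one nonempty heap is, for
-- play, determined by its box B = (x , y): the largest heap-1 size x and the largest
-- heap-2 size y in Q (Shape Q B).  A Q-move M turns (x , y) into  after M (x , y),
-- whose first component is the largest x - t over the moves (1,-t) of M (0 if none),
-- and the result is again of this kind (shape-after).  The box (x , y) has nim-value
--  value (x , y),  which is max(x,y) - 1 + δ x y when x, y > 0.

open import Defs
open import Data.Nat using (ℕ; zero; suc; _<_; _≤_; s≤s; z≤n; _+_; _∸_; _⊔_; _≟_; _≤?_; _<?_)
open import Data.Nat.Properties
open import Data.Nat.Induction using (<-wellFounded)
open import Induction.WellFounded using (Acc; acc)
open import Data.Product using (_×_; _,_; ∃-syntax; proj₁; proj₂; uncurry)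
open import Data.Sum using (_⊎_; inj₁; inj₂)
open import Data.List using (List; []; _∷_; map; filter; cartesianProduct)
open import Data.List.Relation.Unary.All using (All; []; _∷_; lookup)
open import Data.List.Relation.Unary.Any using (here; there)
open import Data.List.Membership.Propositional using (_∈_; _∉_)
open import Data.List.Membership.Propositional.Properties
  using (∈-map∘filter⁻; ∈-map∘filter⁺; ∈-cartesianProduct⁺; ∈-cartesianProduct⁻)
open import Relation.Binary.PropositionalEquality using (_≡_; _≢_; refl; sym; trans; cong; cong₂; subst)
open import Relation.Binary.Definitions using (tri<; tri≈; tri>)
open import Relation.Nullary using (Dec; yes; no)
open import Relation.Nullary.Decidable using (_×-dec_)
open import Function.Bundles using (_⇔_; mk⇔; Equivalence)
open import Data.Empty using (⊥-elim)
open Equivalence using (to; from)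

-- Certified p r n: position p is certified to have nim-value n, at rank r.
module NimValueCriterion
  (G : Graph)
  (Certified : Pos G → ℕ → ℕ → Set)
  (options-differ : ∀ {p r n q} → Certified p r n → Opt G p q →
                    ∃[ r′ ] ∃[ m ] (r′ < r × m ≢ n × Certified q r′ m))
  (smaller-reached : ∀ {p r n m} → Certified p r n → m < n →
                     ∃[ q ] ∃[ r′ ] (Opt G p q × r′ < r × Certified q r′ m))
  where

  private
    GX NX : Graph
    GX = G ⊕ TreeGraph
    NX = NimGraph ⊕ TreeGraph

  Agree : Pos G → ℕ → Tree → Set
  Agree p n X = (Lose GX (p , X) ⇔ Lose NX (n , X)) × (Win GX (p , X) ⇔ Win NX (n , X))

  agree-step : ∀ {p r n ts} → Certified p r n → All (Agree p n) ts →
               (∀ {q r′ m} → r′ < r → Certified q r′ m → Agree q m (node ts)) →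
               Agree p n (node ts)
  agree-step {p} {r} {n} {ts} c agreeX agreeQ =
    mk⇔ lose→lose lose←lose , mk⇔ win→win win←win
    where
    X : Tree
    X = node ts

    -- If every option of *n + X wins, then so does every option q + X of p + X:
    -- q has value m ≢ n; for m < n this is an option of *n + X, for m > n the
    -- position q + X can move to one of value n, which then loses.
    option-wins : (∀ {y} → Opt NX (n , X) y → Win NX y) →
                  ∀ {q} → Opt G p q → Win GX (q , X)
    option-wins f o with options-differ c o
    ... | r′ , m , r′<r , m≢n , c′ with <-cmp m n
    ...   | tri< m<n _ _ = from (proj₂ (agreeQ r′<r c′)) (f (inj₁ (m<n , refl)))
    ...   | tri≈ _ m≡n _ = ⊥-elim (m≢n m≡n)
    ...   | tri> _ _ n<m =
            let (q₂ , r″ , o₂ , r″<r′ , c″) = smaller-reached c′ n<m in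
            win (inj₁ (o₂ , refl)) (from (proj₁ (agreeQ (<-trans r″<r′ r′<r) c″)) (lose f))

    -- Each direction answers a move in one sum by the corresponding move in the
    -- other: a Nim move to *m matches an option of value m, and conversely.
    lose→lose : Lose GX (p , X) → Lose NX (n , X)
    lose→lose (lose f) = lose λ where
      (inj₁ (m<n , refl)) →
        let (q , r′ , o , r′<r , c′) = smaller-reached c m<n in
        to (proj₂ (agreeQ r′<r c′)) (f (inj₁ (o , refl)))
      (inj₂ (refl , X′∈)) → to (proj₂ (lookup agreeX X′∈)) (f (inj₂ (refl , X′∈)))

    lose←lose : Lose NX (n , X) → Lose GX (p , X)
    lose←lose (lose f) = lose λ where
      (inj₁ (o , refl)) → option-wins f o
      (inj₂ (refl , X′∈)) → from (proj₂ (lookup agreeX X′∈)) (f (inj₂ (refl , X′∈)))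

    win→win : Win GX (p , X) → Win NX (n , X)
    win→win (win (inj₁ (o , refl)) l) with options-differ c o
    ... | r′ , m , r′<r , m≢n , c′ with <-cmp m n | to (proj₁ (agreeQ r′<r c′)) l
    ...   | tri< m<n _ _ | lm = win (inj₁ (m<n , refl)) lm
    ...   | tri≈ _ m≡n _ | _ = ⊥-elim (m≢n m≡n)
    ...   | tri> _ _ n<m | lose g = g (inj₁ (n<m , refl))
    win→win (win (inj₂ (refl , X′∈)) l) =
      win (inj₂ (refl , X′∈)) (to (proj₁ (lookup agreeX X′∈)) l)

    win←win : Win NX (n , X) → Win GX (p , X)
    win←win (win (inj₁ (m<n , refl)) l) =
      let (q , r′ , o , r′<r , c′) = smaller-reached c m<n in
      win (inj₁ (o , refl)) (from (proj₁ (agreeQ r′<r c′)) l)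
    win←win (win (inj₂ (refl , X′∈)) l) =
      win (inj₂ (refl , X′∈)) (from (proj₁ (lookup agreeX X′∈)) l)

  mutual
    agree : ∀ {p r n} → Acc _<_ r → Certified p r n → ∀ X → Agree p n X
    agree (acc smaller) c (node ts) =
      agree-step c (agree-all (acc smaller) c ts)
        (λ r′<r c′ → agree (smaller r′<r) c′ (node ts))

    agree-all : ∀ {p r n} → Acc _<_ r → Certified p r n → ∀ ts → All (Agree p n) ts
    agree-all a c [] = []
    agree-all a c (t ∷ ts) = agree a c t ∷ agree-all a c ts

  certified⇒≡star : ∀ {p r n} → Certified p r n → (G , p) ≡g star n
  certified⇒≡star c = agree (<-wellFounded _) c

legal? : ∀ m G → Dec (Legal m G)
legal? (mv h₁ t) (a , b) = (1 ≤? t) ×-dec (t ≤? a)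
legal? (mv h₂ t) (a , b) = (1 ≤? t) ×-dec (t ≤? b)

play : QPos → List CMove → QPos
play Q M = map (uncurry apply) (filter (uncurry legal?) (cartesianProduct M Q))

play-result : ∀ Q M → Result Q M (play Q M)
play-result Q M p = mk⇔ sound complete
  where
  sound : p ∈ play Q M → ∃[ m ] ∃[ G ] (m ∈ M × G ∈ Q × Legal m G × p ≡ apply m G)
  sound p∈ with (m , G) , mG∈ , refl , l ←
      ∈-map∘filter⁻ (uncurry apply) (uncurry legal?) {xs = cartesianProduct M Q} p∈ =
    let (m∈ , G∈) = ∈-cartesianProduct⁻ M Q mG∈ in m , G , m∈ , G∈ , l , refl
  complete : ∃[ m ] ∃[ G ] (m ∈ M × G ∈ Q × Legal m G × p ≡ apply m G) → p ∈ play Q M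
  complete (m , G , m∈ , G∈ , l , refl) =
    ∈-map∘filter⁺ (uncurry apply) (uncurry legal?) ((m , G) , ∈-cartesianProduct⁺ m∈ G∈ , refl , l)

size : Heap → ClassicalPos → ℕ
size h₁ = proj₁
size h₂ = proj₂

legal⇒bounds : ∀ {h t G} → Legal (mv h t) G → 1 ≤ t × t ≤ size h G
legal⇒bounds {h₁} l = l
legal⇒bounds {h₂} l = l

bounds⇒legal : ∀ {h t G} → 1 ≤ t × t ≤ size h G → Legal (mv h t) G
bounds⇒legal {h₁} l = l
bounds⇒legal {h₂} l = l

size-apply : ∀ h t G → size h (apply (mv h t) G) ≡ size h G ∸ t
size-apply h₁ t G = refl
size-apply h₂ t G = refl

shrink : Heap → CMove → ℕ → ℕ
shrink h₁ (mv h₁ t) x = x ∸ t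
shrink h₂ (mv h₂ t) x = x ∸ t
shrink h₁ (mv h₂ t) x = 0
shrink h₂ (mv h₁ t) x = 0

maxAfter : Heap → List CMove → ℕ → ℕ
maxAfter h [] x = 0
maxAfter h (m ∷ M) x = shrink h m x ⊔ maxAfter h M x

member≤maxAfter : ∀ h {t M} x → mv h t ∈ M → x ∸ t ≤ maxAfter h M x
member≤maxAfter h₁ x (here refl) = m≤m⊔n _ _
member≤maxAfter h₂ x (here refl) = m≤m⊔n _ _
member≤maxAfter h x (there t∈) = m≤n⇒m≤o⊔n _ (member≤maxAfter h x t∈)

maxAfter-attained : ∀ h M x →
  maxAfter h M x ≡ 0 ⊎ ∃[ t ] (mv h t ∈ M × maxAfter h M x ≡ x ∸ t)
maxAfter-attained h [] x = inj₁ refl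
maxAfter-attained h (m ∷ M) x with ⊔-sel (shrink h m x) (maxAfter h M x)
maxAfter-attained h₁ (mv h₁ t ∷ M) x | inj₁ e = inj₂ (t , here refl , e)
maxAfter-attained h₂ (mv h₂ t ∷ M) x | inj₁ e = inj₂ (t , here refl , e)
maxAfter-attained h₁ (mv h₂ t ∷ M) x | inj₁ e = inj₁ e
maxAfter-attained h₂ (mv h₁ t ∷ M) x | inj₁ e = inj₁ e
... | inj₂ e with maxAfter-attained h M x
...   | inj₁ e′ = inj₁ (trans e e′)
...   | inj₂ (t , t∈ , e′) = inj₂ (t , there t∈ , trans e e′)

maxAfter≤ : ∀ h M x → maxAfter h M x ≤ x
maxAfter≤ h [] x = z≤n
maxAfter≤ h (m ∷ M) x = ⊔-lub (shrink≤ h m) (maxAfter≤ h M x)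
  where
  shrink≤ : ∀ h m → shrink h m x ≤ x
  shrink≤ h₁ (mv h₁ t) = m∸n≤m x t
  shrink≤ h₂ (mv h₂ t) = m∸n≤m x t
  shrink≤ h₁ (mv h₂ t) = z≤n
  shrink≤ h₂ (mv h₁ t) = z≤n

maxAfter< : ∀ h M x → (∀ {t} → mv h t ∈ M → 1 ≤ t) → 0 < x → maxAfter h M x < x
maxAfter< h [] x _ 0<x = 0<x
maxAfter< h (m ∷ M) (suc x) pos _ =
  s≤s (⊔-lub (shrink-drops h m (λ { refl → pos (here refl) }))
             (≤-pred (maxAfter< h M (suc x) (λ t∈ → pos (there t∈)) (s≤s z≤n))))
  where
  shrink-drops : ∀ h m → (∀ {t} → m ≡ mv h t → 1 ≤ t) → shrink h m (suc x) ≤ x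
  shrink-drops h₁ (mv h₁ t) pos = ∸-monoʳ-≤ (suc x) (pos refl)
  shrink-drops h₂ (mv h₂ t) pos = ∸-monoʳ-≤ (suc x) (pos refl)
  shrink-drops h₁ (mv h₂ t) pos = z≤n
  shrink-drops h₂ (mv h₁ t) pos = z≤n

OnHeap : Heap → List CMove → Set
OnHeap h M = ∀ {m} → m ∈ M → CMove.heap m ≡ h

maxAfter-other : ∀ {h h′ M} x → OnHeap h M → h′ ≢ h → maxAfter h′ M x ≡ 0
maxAfter-other {M = []} x on h′≢h = refl
maxAfter-other {h} {h′} {m ∷ M} x on h′≢h =
  cong₂ _⊔_ (shrink-other h′ m (λ e → h′≢h (trans (sym e) (on (here refl)))))
            (maxAfter-other x (λ m∈ → on (there m∈)) h′≢h)
  where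
  shrink-other : ∀ h′ m → CMove.heap m ≢ h′ → shrink h′ m x ≡ 0
  shrink-other h₁ (mv h₁ t) ne = ⊥-elim (ne refl)
  shrink-other h₂ (mv h₂ t) ne = ⊥-elim (ne refl)
  shrink-other h₁ (mv h₂ t) ne = refl
  shrink-other h₂ (mv h₁ t) ne = refl

maxAfter-positive : ∀ {h M m₁ m₂} x → OnHeap h M → (∀ {t} → mv h t ∈ M → t ≤ x) →
  m₁ ∈ M → m₂ ∈ M → m₁ ≢ m₂ → 0 < maxAfter h M x
maxAfter-positive {h} {M} {mv _ t} {mv _ u} x on bound t∈ u∈ ne
  with on t∈ | on u∈
... | refl | refl with m≤n⇒m<n∨m≡n (bound t∈) | m≤n⇒m<n∨m≡n (bound u∈)
...   | inj₁ t<x | _ = ≤-trans (m<n⇒0<n∸m t<x) (member≤maxAfter h x t∈)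
...   | inj₂ _ | inj₁ u<x = ≤-trans (m<n⇒0<n∸m u<x) (member≤maxAfter h x u∈)
...   | inj₂ refl | inj₂ refl = ⊥-elim (ne refl)

heap-moves? : ∀ h M → (∃[ t ] mv h t ∈ M) ⊎ (∀ {t} → mv h t ∉ M)
heap-moves? h [] = inj₂ λ ()
heap-moves? h₁ (mv h₁ t ∷ M) = inj₁ (t , here refl)
heap-moves? h₂ (mv h₂ t ∷ M) = inj₁ (t , here refl)
heap-moves? h₁ (mv h₂ t ∷ M) with heap-moves? h₁ M
... | inj₁ (u , u∈) = inj₁ (u , there u∈)
... | inj₂ none = inj₂ λ { (here ()) ; (there u∈) → none u∈ }
heap-moves? h₂ (mv h₁ t ∷ M) with heap-moves? h₂ M
... | inj₁ (u , u∈) = inj₁ (u , there u∈)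
... | inj₂ none = inj₂ λ { (here ()) ; (there u∈) → none u∈ }

spread : ∀ M → (∃[ t ] ∃[ u ] (mv h₁ t ∈ M × mv h₂ u ∈ M)) ⊎ OnHeap h₁ M ⊎ OnHeap h₂ M
spread M with heap-moves? h₁ M | heap-moves? h₂ M
... | inj₁ (t , t∈) | inj₁ (u , u∈) = inj₁ (t , u , t∈ , u∈)
... | _ | inj₂ none₂ = inj₂ (inj₁ λ { {mv h₁ t} _ → refl ; {mv h₂ t} t∈ → ⊥-elim (none₂ t∈) })
... | inj₂ none₁ | _ = inj₂ (inj₂ λ { {mv h₁ t} t∈ → ⊥-elim (none₁ t∈) ; {mv h₂ t} _ → refl })

after : List CMove → ℕ × ℕ → ℕ × ℕ
after M (x , y) = maxAfter h₁ M x , maxAfter h₂ M y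

size-after : ∀ h M B → size h (after M B) ≡ maxAfter h M (size h B)
size-after h₁ M (x , y) = refl
size-after h₂ M (x , y) = refl

InBox : ℕ × ℕ → ClassicalPos → Set
InBox B p = (size h₁ p ≡ 0 ⊎ size h₂ p ≡ 0) × (∀ h → size h p ≤ size h B)

record Shape (Q : QPos) (B : ℕ × ℕ) : Set where
  field
    in-box   : ∀ {p} → p ∈ Q → InBox B p
    attained : ∀ h → ∃[ p ] (p ∈ Q × size h p ≡ size h B)
open Shape

move-bounds : ∀ {Q B M h t} → Shape Q B → (∀ {m} → m ∈ M → LegalQ m Q) → mv h t ∈ M →
              1 ≤ t × t ≤ size h B
move-bounds {h = h} sh legal t∈ =
  let (G , G∈ , l) = legal t∈
      (1≤t , t≤G) = legal⇒bounds {h} l in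
  1≤t , ≤-trans t≤G (proj₂ (in-box sh G∈) h)

-- Conversely such a move is legal in Q: it is legal where the maximum is attained.
bounds⇒legalQ : ∀ {Q B} h {t} → Shape Q B → 1 ≤ t → t ≤ size h B → LegalQ (mv h t) Q
bounds⇒legalQ h {t} sh 1≤t t≤B =
  let (G , G∈ , e) = attained sh h in
  G , G∈ , bounds⇒legal {h} (1≤t , subst (t ≤_) (sym e) t≤B)

moved-in-box : ∀ {B M h t a b} → InBox B (a , b) → Legal (mv h t) (a , b) → mv h t ∈ M →
               InBox (after M B) (apply (mv h t) (a , b))
moved-in-box {h = h₁} (inj₁ refl , _) (s≤s _ , ()) _
moved-in-box {h = h₂} (inj₂ refl , _) (s≤s _ , ()) _
moved-in-box {B} {h = h₁} {t} (inj₂ refl , fits) _ t∈ = inj₂ refl , λ where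
  h₁ → ≤-trans (∸-monoˡ-≤ t (fits h₁)) (member≤maxAfter h₁ (size h₁ B) t∈)
  h₂ → z≤n
moved-in-box {B} {h = h₂} {t} (inj₁ refl , fits) _ t∈ = inj₁ refl , λ where
  h₁ → z≤n
  h₂ → ≤-trans (∸-monoˡ-≤ t (fits h₂)) (member≤maxAfter h₂ (size h₂ B) t∈)

shape-after : ∀ {Q B M Q′} → Shape Q B → (∀ {m} → m ∈ M → LegalQ m Q) → (∃[ m ] m ∈ M) →
              Result Q M Q′ → Shape Q′ (after M B)
shape-after {Q} {B} {M} {Q′} sh legal (m₀ , m₀∈) result =
  record { in-box = box′ ; attained = attained′ }
  where
  box′ : ∀ {p} → p ∈ Q′ → InBox (after M B) p
  box′ p∈ with to (result _) p∈
  ... | mv h t , G , t∈ , G∈ , l , refl = moved-in-box (in-box sh G∈) l t∈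

  reached : ∀ {m G} → m ∈ M → G ∈ Q → Legal m G → apply m G ∈ Q′
  reached m∈ G∈ l = from (result _) (_ , _ , m∈ , G∈ , l , refl)

  attained′ : ∀ h → ∃[ p ] (p ∈ Q′ × size h p ≡ size h (after M B))
  attained′ h with maxAfter-attained h M (size h B)
  ... | inj₁ e =
    let (G , G∈ , l) = legal m₀∈
        p∈ = reached m₀∈ G∈ l
        e′ = trans (size-after h M B) e
        size≤0 = subst (size h (apply m₀ G) ≤_) e′ (proj₂ (box′ p∈) h) in
    apply m₀ G , p∈ , trans (n≤0⇒n≡0 size≤0) (sym e′)
  ... | inj₂ (t , t∈ , e) =
    let (G , G∈ , eG) = attained sh h
        (1≤t , t≤B) = move-bounds sh legal t∈
        l = bounds⇒legal {h} (1≤t , subst (t ≤_) (sym eG) t≤B) in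
    apply (mv h t) G , reached t∈ G∈ l ,
    trans (size-apply h t G) (trans (cong (_∸ t) eG) (sym (trans (size-after h M B) e)))

-- The nim-value of a box; for x, y > 0 it is max(x,y) - 1 + δ x y.
value : ℕ × ℕ → ℕ
value (zero , y) = y ∸ 1
value (suc a , zero) = a
value (suc a , suc b) = a ⊔ b + δ a b

-- Total size of a box; it decreases along every move.
rank : ℕ × ℕ → ℕ
rank (x , y) = x + y

δ-refl : ∀ a → δ a a ≡ 1
δ-refl zero = refl
δ-refl (suc a) = δ-refl a

δ-≢ : ∀ {a b} → a ≢ b → δ a b ≡ 0
δ-≢ {zero} {zero} ne = ⊥-elim (ne refl)
δ-≢ {zero} {suc b} ne = refl
δ-≢ {suc a} {zero} ne = refl
δ-≢ {suc a} {suc b} ne = δ-≢ (λ e → ne (cong suc e))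

value-diag : ∀ a → value (a , a) ≡ a
value-diag zero = refl
value-diag (suc a) rewrite δ-refl a | ⊔-idem a = +-comm a 1

max≤value : ∀ a b → a ⊔ b ≤ value (suc a , suc b)
max≤value a b = m≤m+n (a ⊔ b) (δ a b)

value-≥₁ : ∀ a y → a ≤ value (suc a , y)
value-≥₁ a zero = ≤-refl
value-≥₁ a (suc b) = ≤-trans (m≤m⊔n a b) (max≤value a b)

value-≥₂ : ∀ x b → b ≤ value (x , suc b)
value-≥₂ zero b = ≤-refl
value-≥₂ (suc a) b = ≤-trans (m≤n⊔m a b) (max≤value a b)

value-positive : ∀ a b → 0 < value (suc a , suc b)
value-positive zero zero = s≤s z≤n
value-positive zero (suc b) = s≤s z≤n
value-positive (suc a) zero = s≤s z≤n
value-positive (suc a) (suc b) = s≤s z≤n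

value-drop₁ : ∀ {x′ x} y → 0 < x′ → x′ < x → value (x′ , 0) < value (x , y)
value-drop₁ {suc c} {suc a} y _ x′<x = <-≤-trans (≤-pred x′<x) (value-≥₁ a y)

value-drop₂ : ∀ {y′ y} x → 0 < y′ → y′ < y → value (0 , y′) < value (x , y)
value-drop₂ {suc c} {suc b} x _ y′<y = <-≤-trans (≤-pred y′<y) (value-≥₂ x b)

diag-below : ∀ {c a b} → c < a → c < b → suc c < value (suc a , suc b)
diag-below {c} {a} {b} c<a c<b with <-cmp a b
... | tri< a<b _ _ = ≤-trans (≤-trans (s≤s c<a) a<b) (≤-trans (m≤n⊔m a b) (max≤value a b))
... | tri> _ _ b<a = ≤-trans (≤-trans (s≤s c<b) b<a) (≤-trans (m≤m⊔n a b) (max≤value a b))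
... | tri≈ _ refl _ = subst (suc c <_) (sym (value-diag (suc a))) (s≤s c<a)

value-drop : ∀ {x′ y′ x y} → x′ < x → y′ < y → value (x′ , y′) < value (x , y)
value-drop {zero} {zero} {suc a} {suc b} _ _ = value-positive a b
value-drop {zero} {suc d} {x} _ y′<y = value-drop₂ x (s≤s z≤n) y′<y
value-drop {suc c} {zero} {_} {y} x′<x _ = value-drop₁ y (s≤s z≤n) x′<x
value-drop {suc c} {suc d} {suc a} {suc b} (s≤s c<a) (s≤s d<b) with c ≟ d
... | yes refl = subst (_< value (suc a , suc b)) (sym (value-diag (suc c))) (diag-below c<a d<b)
... | no c≢d rewrite δ-≢ c≢d | +-identityʳ (c ⊔ d) =
  <-≤-trans (⊔-mono-< c<a d<b) (max≤value a b)

value-gap : ∀ {a b m} → m < value (suc a , suc b) → a ≤ m → b ≤ m → b ≡ a × m ≡ a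
value-gap {a} {b} {m} m<v a≤m b≤m with a ≟ b
... | no a≢b rewrite δ-≢ a≢b | +-identityʳ (a ⊔ b) = ⊥-elim (<⇒≱ m<v (⊔-lub a≤m b≤m))
... | yes refl rewrite δ-refl a | ⊔-idem a | +-comm a 1 = refl , ≤-antisym (≤-pred m<v) a≤m

Certified : QPos → ℕ → ℕ → Set
Certified Q r n = ∃[ B ] (Shape Q B × r ≡ rank B × n ≡ value B)

heap-shrinks : ∀ {Q B M} h → Shape Q B → (∀ {m} → m ∈ M → LegalQ m Q) →
               0 < size h B → maxAfter h M (size h B) < size h B
heap-shrinks {M = M} h sh legal = maxAfter< h M _ (λ t∈ → proj₁ (move-bounds sh legal t∈))

heap-survives : ∀ {Q B M} h → Shape Q B → AllowedA Q M → OnHeap h M → 0 < maxAfter h M (size h B)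
heap-survives h sh (legal , m₁ , m₂ , m₁∈ , m₂∈ , m₁≢m₂) on =
  maxAfter-positive _ on (λ t∈ → proj₂ (move-bounds sh legal t∈)) m₁∈ m₂∈ m₁≢m₂

move-decreases : ∀ {Q M} B → Shape Q B → AllowedA Q M →
                 rank (after M B) < rank B × value (after M B) < value B
move-decreases {M = M} (x , y) sh allowed@(legal , _) with spread M
... | inj₁ (t , u , t∈ , u∈) = +-mono-< x′<x y′<y , value-drop x′<x y′<y
  where
  x′<x : maxAfter h₁ M x < x
  x′<x = heap-shrinks h₁ sh legal (uncurry ≤-trans (move-bounds sh legal t∈))
  y′<y : maxAfter h₂ M y < y
  y′<y = heap-shrinks h₂ sh legal (uncurry ≤-trans (move-bounds sh legal u∈))
... | inj₂ (inj₁ on₁) rewrite maxAfter-other {h′ = h₂} {M} y on₁ (λ ()) =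
  +-mono-<-≤ x′<x z≤n , value-drop₁ y 0<x′ x′<x
  where
  0<x′ : 0 < maxAfter h₁ M x
  0<x′ = heap-survives h₁ sh allowed on₁
  x′<x : maxAfter h₁ M x < x
  x′<x = heap-shrinks h₁ sh legal (<-≤-trans 0<x′ (maxAfter≤ h₁ M x))
... | inj₂ (inj₂ on₂) rewrite maxAfter-other {h′ = h₁} {M} x on₂ (λ ()) =
  <-≤-trans y′<y (m≤n+m y x) , value-drop₂ x 0<y′ y′<y
  where
  0<y′ : 0 < maxAfter h₂ M y
  0<y′ = heap-survives h₂ sh allowed on₂
  y′<y : maxAfter h₂ M y < y
  y′<y = heap-shrinks h₂ sh legal (<-≤-trans 0<y′ (maxAfter≤ h₂ M y))

options-differ : ∀ {Q r n Q′} → Certified Q r n → Opt QNimA Q Q′ →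
                 ∃[ r′ ] ∃[ m ] (r′ < r × m ≢ n × Certified Q′ r′ m)
options-differ (B , sh , refl , refl) (M , allowed@(legal , m₁ , _ , m₁∈ , _) , result) =
  let (rank< , value<) = move-decreases B sh allowed in
  rank (after M B) , value (after M B) , rank< , <⇒≢ value< ,
  after M B , shape-after sh legal (m₁ , m₁∈) result , refl , refl

Reaches : QPos → ℕ → ℕ → Set
Reaches Q r m = ∃[ Q′ ] ∃[ r′ ] (Opt QNimA Q Q′ × r′ < r × Certified Q′ r′ m)

two-move : ∀ {Q B B′ m₁ m₂} → Shape Q B → LegalQ m₁ Q → LegalQ m₂ Q → m₁ ≢ m₂ →
           after (m₁ ∷ m₂ ∷ []) B ≡ B′ → rank B′ < rank B → Reaches Q (rank B) (value B′)
two-move {Q} {B} {m₁ = m₁} {m₂} sh l₁ l₂ m₁≢m₂ refl rank< =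
  play Q M , rank (after M B) ,
  (M , (legal , m₁ , m₂ , here refl , there (here refl) , m₁≢m₂) , play-result Q M) , rank< ,
  after M B , shape-after sh legal (m₁ , here refl) (play-result Q M) , refl , refl
  where
  M : List CMove
  M = m₁ ∷ m₂ ∷ []
  legal : ∀ {m} → m ∈ M → LegalQ m Q
  legal (here refl) = l₁
  legal (there (here refl)) = l₂

axis : Heap → ℕ → ℕ × ℕ
axis h₁ n = n , 0
axis h₂ n = 0 , n

value-axis : ∀ h m → value (axis h (suc m)) ≡ m
value-axis h₁ m = refl
value-axis h₂ m = refl

rank-axis : ∀ h n → rank (axis h n) ≡ n
rank-axis h₁ n = +-identityʳ n
rank-axis h₂ n = refl

size≤rank : ∀ h B → size h B ≤ rank B
size≤rank h₁ (x , y) = m≤m+n x y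
size≤rank h₂ (x , y) = m≤n+m y x

-- Removing a - m resp. a + 1 tokens from a heap of size a + 1 leaves m + 1 resp. 0,
-- so the largest remainder is m + 1.
cut-max : ∀ a m → m ≤ a → (suc a ∸ (a ∸ m)) ⊔ ((a ∸ a) ⊔ 0) ≡ suc m
cut-max a m m≤a
  rewrite n∸n≡0 a | ⊔-identityʳ (suc a ∸ (a ∸ m))
        | +-∸-assoc 1 (m∸n≤m a m) | m∸[m∸n]≡n m≤a = refl

after-cut : ∀ h {a m} B → size h B ≡ suc a → m ≤ a →
            after (mv h (a ∸ m) ∷ mv h (suc a) ∷ []) B ≡ axis h (suc m)
after-cut h₁ {a} {m} (x , y) refl m≤a = cong (_, 0) (cut-max a m m≤a)
after-cut h₂ {a} {m} (x , y) refl m≤a = cong (0 ,_) (cut-max a m m≤a)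

cut-option : ∀ h {Q B a m} → Shape Q B → size h B ≡ suc a → m < a → Reaches Q (rank B) m
cut-option h {Q} {B} {a} {m} sh eB m<a =
  subst (Reaches Q (rank B)) (value-axis h m)
    (two-move sh legal-cut legal-all distinct (after-cut h B eB (<⇒≤ m<a)) rank<)
  where
  a<B : a < size h B
  a<B = ≤-reflexive (sym eB)
  legal-cut : LegalQ (mv h (a ∸ m)) Q
  legal-cut = bounds⇒legalQ h sh (m<n⇒0<n∸m m<a) (≤-trans (m∸n≤m a m) (<⇒≤ a<B))
  legal-all : LegalQ (mv h (suc a)) Q
  legal-all = bounds⇒legalQ h sh (s≤s z≤n) a<B
  distinct : mv h (a ∸ m) ≢ mv h (suc a)
  distinct e = <⇒≢ (s≤s (m∸n≤m a m)) (cong CMove.tokens e)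
  rank< : rank (axis h (suc m)) < rank B
  rank< = subst (_< rank B) (sym (rank-axis h (suc m)))
            (≤-trans (s≤s m<a) (≤-trans a<B (size≤rank h B)))

diagonal-option : ∀ {Q a} → Shape Q (suc a , suc a) → Reaches Q (rank (suc a , suc a)) a
diagonal-option {Q} {a} sh =
  subst (Reaches Q _) (value-diag a)
    (two-move {m₁ = mv h₁ 1} {mv h₂ 1} sh legal₁ legal₂ (λ ()) after-diag rank<)
  where
  legal₁ : LegalQ (mv h₁ 1) Q
  legal₁ = bounds⇒legalQ h₁ sh (s≤s z≤n) (s≤s z≤n)
  legal₂ : LegalQ (mv h₂ 1) Q
  legal₂ = bounds⇒legalQ h₂ sh (s≤s z≤n) (s≤s z≤n)
  after-diag : after (mv h₁ 1 ∷ mv h₂ 1 ∷ []) (suc a , suc a) ≡ (a , a)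
  after-diag = cong₂ _,_ (⊔-identityʳ a) (⊔-identityʳ a)
  rank< : rank (a , a) < rank (suc a , suc a)
  rank< = +-mono-< (n<1+n a) (n<1+n a)

-- Every value below that of the box is reached: by cutting the larger heap, or, on the
-- diagonal, by the Q-move {(1,-1), (2,-1)} (the only value not reached by cutting).
reach-below : ∀ {Q m} B → Shape Q B → m < value B → Reaches Q (rank B) m
reach-below (zero , zero) sh ()
reach-below (zero , suc b) sh m<b = cut-option h₂ sh refl m<b
reach-below (suc a , zero) sh m<a = cut-option h₁ sh refl m<a
reach-below {m = m} (suc a , suc b) sh m<v with m <? a | m <? b
... | yes m<a | _ = cut-option h₁ sh refl m<a
... | no _ | yes m<b = cut-option h₂ sh refl m<b
... | no m≮a | no m≮b with value-gap {a} {b} m<v (≮⇒≥ m≮a) (≮⇒≥ m≮b)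
...   | refl , refl = diagonal-option sh

smaller-reached : ∀ {Q r n m} → Certified Q r n → m < n → Reaches Q r m
smaller-reached (B , sh , refl , refl) m<n = reach-below B sh m<n

open NimValueCriterion QNimA Certified options-differ smaller-reached

initial-shape : ∀ i j → Shape (Nim i 0 ∷ Nim 0 j ∷ []) (i , j)
initial-shape i j = record { in-box = box ; attained = top }
  where
  box : ∀ {p} → p ∈ (Nim i 0 ∷ Nim 0 j ∷ []) → InBox (i , j) p
  box (here refl) = inj₂ refl , λ { h₁ → ≤-refl ; h₂ → z≤n }
  box (there (here refl)) = inj₁ refl , λ { h₁ → z≤n ; h₂ → ≤-refl }
  top : ∀ h → ∃[ p ] (p ∈ (Nim i 0 ∷ Nim 0 j ∷ []) × size h p ≡ size h (i , j))
  top h₁ = Nim i 0 , here refl , refl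
  top h₂ = Nim 0 j , there (here refl) , refl

mainTheorem9 : ∀ (i j : ℕ) → 0 < i → 0 < j →
    ⟨ Nim i 0 ∷ Nim 0 j ∷ [] ⟩A ≡g star ((i ⊔ j) ∸ 1 + δ i j)
mainTheorem9 (suc a) (suc b) _ _ =
  certified⇒≡star ((suc a , suc b) , initial-shape (suc a) (suc b) , refl , refl)
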